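{- Let $G=(V,E,w)$ be a weighted graph on $d$ vertices. Then the rational function $J_G\in\mathbb{Q}(X_1,\dots,X_d)$ is not identically zero.
   Context: A weighted graph is $G=(V,E,w)$ with $V=\{v_1,\dots,v_d\}$, $E$ a set of unordered edges between distinct vertices, and $w:E\to\mathbb{Z}_{\ge0}$. $S_d$ acts by permuting vertices: $\sigma(G)=(V,\sigma(E),\sigma(w))$ with $\sigma(E)=\{v_{\sigma(i)}v_{\sigma(j)}:v_iv_j\in E\}$ and $\sigma(w)(v_{\sigma(i)}v_{\sigma(j)})=w(v_iv_j)$. For $\sigma\in S_d/\mathrm{Stab}_{S_d}(G)$, $S_G^\sigma=1/\prod_{v_iv_j\in\sigma(E)}(X_i-X_j)^{2\sigma(w)(v_iv_j)}$, and $J_G=\sum_{\sigma\in S_d/\mathrm{Stab}_{S_d}(G)}S_G^\sigma$. -}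

module Defs where

open import Data.Bool using (Bool; true; false; _∧_; _∨_; not)
open import Data.Nat using (ℕ; zero; suc) renaming (_*_ to _*ℕ_; _≟_ to _≟ℕ_)
open import Data.Fin using (Fin; zero; suc) renaming (_≟_ to _≟ᶠ_; _<?_ to _<ᶠ?_)
open import Data.List using (List; []; _∷_; map; concatMap; filterᵇ; deduplicate; foldr; allFin)
open import Data.Bool.ListAction using (and)
open import Data.Maybe using (Maybe; just; nothing)
open import Data.Product using (_×_; _,_; proj₁; proj₂)
open import Data.Rational using (ℚ; 0ℚ; 1ℚ; _+_; _*_; _-_; 1/_)
open import Data.Rational.Properties using () renaming (_≟_ to _≟ℚ_)
open import Relation.Nullary using (yes; no; does)
open import Relation.Binary.PropositionalEquality using (_≡_)
import Data.List.Properties as LP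
import Data.Maybe.Properties as MP

-- A weighted graph on vertex set Fin d: edge i j = just w  iff  v_i v_j ∈ E with weight w.
-- (Edges of weight 0 are genuine edges, distinct from non-edges.)
EdgeFun : ℕ → Set
EdgeFun d = Fin d → Fin d → Maybe ℕ

record WGraph (d : ℕ) : Set where
  field
    edge      : EdgeFun d
    loopless  : ∀ i → edge i i ≡ nothing
    symmetric : ∀ i j → edge i j ≡ edge j i
open WGraph public

pairs : (d : ℕ) → List (Fin d × Fin d)
pairs d = concatMap (λ i → map (λ j → (i , j)) (allFin d)) (allFin d)

-- pairs with i < j (each unordered edge once)
upperPairs : (d : ℕ) → List (Fin d × Fin d)
upperPairs d = filterᵇ (λ p → does (proj₁ p <ᶠ? proj₂ p)) (pairs d)

consF : ∀ {n m} → Fin m → (Fin n → Fin m) → Fin (suc n) → Fin m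
consF k f zero    = k
consF k f (suc i) = f i

allFuns : (n m : ℕ) → List (Fin n → Fin m)
allFuns zero    m = (λ ()) ∷ []
allFuns (suc n) m = concatMap (λ f → map (λ k → consF k f) (allFin m)) (allFuns n m)

isInjective : ∀ {d} → (Fin d → Fin d) → Bool
isInjective {d} f = and (map (λ p → not (does (f (proj₁ p) ≟ᶠ f (proj₂ p))) ∨ does (proj₁ p ≟ᶠ proj₂ p)) (pairs d))

perms : (d : ℕ) → List (Fin d → Fin d)
perms d = filterᵇ isInjective (allFuns d d)

-- permuted edge data: (τ · e)(a , b) = e (τ a) (τ b).  With τ = σ⁻¹ this is σ(G);
-- as τ ranges over S_d so does σ, hence the list of these gives the orbit S_d · G.
act : ∀ {d} → (Fin d → Fin d) → EdgeFun d → EdgeFun d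
act τ e a b = e (τ a) (τ b)

-- a graph is determined by its table of edge data
table : ∀ {d} → EdgeFun d → List (Maybe ℕ)
table {d} e = map (λ p → e (proj₁ p) (proj₂ p)) (pairs d)

-- the orbit S_d · G, without repetitions; it is in bijection with S_d / Stab(G)
-- via σ Stab(G) ↦ σ(G).
orbit : ∀ {d} → WGraph d → List (EdgeFun d)
orbit {d} G = deduplicate (λ e e′ → LP.≡-dec (MP.≡-dec _≟ℕ_) (table e) (table e′))
                          (map (λ τ → act τ (edge G)) (perms d))

_^ℚ_ : ℚ → ℕ → ℚ
q ^ℚ zero  = 1ℚ
q ^ℚ suc n = q * (q ^ℚ n)

-- total inverse (0 ↦ 0); only applied to nonzero values at points with distinct coordinates
inv : ℚ → ℚ
inv q with q ≟ℚ 0ℚ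
... | yes _ = 0ℚ
... | no ¬0 = 1/_ q {{Data.Rational.≢-nonZero ¬0}}

edgeFactor : ∀ {d} → (Fin d → ℚ) → Fin d → Fin d → Maybe ℕ → ℚ
edgeFactor x a b nothing  = 1ℚ
edgeFactor x a b (just w) = (x a - x b) ^ℚ (2 *ℕ w)

evalS : ∀ {d} → EdgeFun d → (Fin d → ℚ) → ℚ
evalS {d} e x = inv (foldr _*_ 1ℚ (map (λ p → edgeFactor x (proj₁ p) (proj₂ p) (e (proj₁ p) (proj₂ p))) (upperPairs d)))

evalJ : ∀ {d} → WGraph d → (Fin d → ℚ) → ℚ
evalJ G x = foldr _+_ 0ℚ (map (λ e → evalS e x) (orbit G))

-- At a point x with pairwise distinct coordinates each factor (x_a − x_b)^{2w} is a positive
-- rational, so every summand S_H(x) of J_G(x) is positive. The orbit of G is nonempty, hence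
-- J_G(x) > 0; the point x_i = i has distinct coordinates.
module Submission where

open import Defs
open import Data.Bool using (Bool; true; false; T; not; _∨_)
open import Data.Empty using (⊥-elim)
open import Data.Fin using (Fin; toℕ) renaming (_≟_ to _≟ᶠ_; _<?_ to _<ᶠ?_)
open import Data.Fin.Properties using (toℕ-injective; <⇒≢)
open import Data.List using (List; []; _∷_; map; foldr; filterᵇ; allFin; deduplicate)
open import Data.List.Relation.Unary.All as All using (All; []; _∷_)
open import Data.List.Relation.Unary.All.Properties using (all⁻; all-filter; map⁺)
open import Data.List.Relation.Unary.Any as Any using (Any; here; there)
open import Data.List.Relation.Unary.Any.Properties using (concat⁺) renaming (map⁺ to Any-map⁺)
open import Data.List.Membership.Propositional.Properties using (∈-allFin)
open import Data.Maybe using (just; nothing)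
open import Data.Nat using (ℕ; zero; suc; _*_)
open import Data.Nat.Coprimality using (1-coprimeTo) renaming (sym to coprime-sym)
open import Data.Nat.Properties using (*-suc; <ᵇ⇒<)
open import Data.Product using (∃-syntax; _×_; _,_; proj₁)
open import Data.Rational using (ℚ; 0ℚ; 1ℚ; _<_; _+_; _-_; mkℚ+; positive; negative)
  renaming (_*_ to _*ℚ_)
open import Data.Rational.Properties
  using (<-cmp; <-irrefl; positive⁻¹; pos*pos⇒pos; neg*neg⇒pos; pos+pos⇒pos; 1/pos⇒pos;
         +-identityʳ; *-assoc; mkℚ+-injective; +-0-group)
  renaming (_≟_ to _≟ℚ_)
open import Algebra.Properties.Group +-0-group using (x∙y⁻¹≈ε⇒x≈y)
open import Relation.Binary.Definitions using (tri<; tri≈; tri>)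
open import Relation.Binary.PropositionalEquality using (_≡_; _≢_; refl; sym; trans; cong; subst; module ≡-Reasoning)
open import Relation.Nullary using (¬_; Dec; yes; no; does)
open import Relation.Nullary.Decidable using (T?)
open import Function using (id; _∘_)

private
  variable
    A : Set
    p q : ℚ

*-pos : 0ℚ < p → 0ℚ < q → 0ℚ < p *ℚ q
*-pos {p} {q} 0<p 0<q = positive⁻¹ _ {{pos*pos⇒pos p {{positive 0<p}} q {{positive 0<q}}}}

+-pos : 0ℚ < p → 0ℚ < q → 0ℚ < p + q
+-pos {p} {q} 0<p 0<q = positive⁻¹ _ {{pos+pos⇒pos p {{positive 0<p}} q {{positive 0<q}}}}

0<1 : 0ℚ < 1ℚ
0<1 = positive⁻¹ 1ℚ

inv-pos : 0ℚ < p → 0ℚ < inv p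
inv-pos {p} 0<p with p ≟ℚ 0ℚ
... | yes refl = ⊥-elim (<-irrefl refl 0<p)
... | no  _    = positive⁻¹ _ {{1/pos⇒pos p {{positive 0<p}}}}

square-pos : p ≢ 0ℚ → 0ℚ < p *ℚ p
square-pos {p} p≢0 with <-cmp p 0ℚ
... | tri< p<0 _ _ = positive⁻¹ _ {{neg*neg⇒pos p {{negative p<0}} p {{negative p<0}}}}
... | tri≈ _ p≡0 _ = ⊥-elim (p≢0 p≡0)
... | tri> _ _ 0<p = *-pos 0<p 0<p

^ℚ-pos : ∀ n → 0ℚ < p → 0ℚ < p ^ℚ n
^ℚ-pos zero    0<p = 0<1
^ℚ-pos (suc n) 0<p = *-pos 0<p (^ℚ-pos n 0<p)

^ℚ-double : ∀ p n → p ^ℚ (2 * n) ≡ (p *ℚ p) ^ℚ n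
^ℚ-double p zero    = refl
^ℚ-double p (suc n) = begin
  p ^ℚ (2 * suc n)          ≡⟨ cong (p ^ℚ_) (*-suc 2 n) ⟩
  p *ℚ (p *ℚ p ^ℚ (2 * n))  ≡⟨ *-assoc p p _ ⟨
  (p *ℚ p) *ℚ p ^ℚ (2 * n)  ≡⟨ cong ((p *ℚ p) *ℚ_) (^ℚ-double p n) ⟩
  (p *ℚ p) ^ℚ suc n         ∎
  where open ≡-Reasoning

even-power-pos : ∀ n → p ≢ 0ℚ → 0ℚ < p ^ℚ (2 * n)
even-power-pos {p} n p≢0 = subst (0ℚ <_) (sym (^ℚ-double p n)) (^ℚ-pos n (square-pos p≢0))

p≢q⇒p-q≢0 : p ≢ q → p - q ≢ 0ℚ
p≢q⇒p-q≢0 {p} {q} p≢q p-q≡0 = p≢q (x∙y⁻¹≈ε⇒x≈y p q p-q≡0)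

product-pos : {xs : List ℚ} → All (0ℚ <_) xs → 0ℚ < foldr _*ℚ_ 1ℚ xs
product-pos []         = 0<1
product-pos (0<x ∷ ps) = *-pos 0<x (product-pos ps)

sum-pos : {xs : List ℚ} → xs ≢ [] → All (0ℚ <_) xs → 0ℚ < foldr _+_ 0ℚ xs
sum-pos xs≢[] []                 = ⊥-elim (xs≢[] refl)
sum-pos _     (_∷_ {x} 0<x [])   = subst (0ℚ <_) (sym (+-identityʳ x)) 0<x
sum-pos _     (0<x ∷ ps@(_ ∷ _)) = +-pos 0<x (sum-pos (λ ()) ps)

-- Pointwise, since _≡_ on functions is not extensional.
allFuns-complete : ∀ n m (g : Fin n → Fin m) → Any (λ f → ∀ i → f i ≡ g i) (allFuns n m)
allFuns-complete zero    m g = here (λ ())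
allFuns-complete (suc n) m g =
  concat⁺ (Any-map⁺ (Any.map extend (allFuns-complete n m (λ i → g (Fin.suc i)))))
  where
  extend : ∀ {f} → (∀ i → f i ≡ g (Fin.suc i)) →
           Any (λ h → ∀ i → h i ≡ g i) (map (λ k → consF k f) (allFin m))
  extend f≗g∘suc = Any-map⁺ (Any.map (λ { refl Fin.zero → refl ; refl (Fin.suc i) → f≗g∘suc i })
                                     (∈-allFin (g Fin.zero)))

isInjective-complete : ∀ {d} (f : Fin d → Fin d) →
                       (∀ i j → f i ≡ f j → i ≡ j) → T (isInjective f)
isInjective-complete {d} f f-inj = all⁻ _ (All.universal separated (pairs d))
  where
  separated : ∀ ((i , j) : Fin d × Fin d) →
              T (not (does (f i ≟ᶠ f j)) ∨ does (i ≟ᶠ j))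
  separated (i , j) with f i ≟ᶠ f j | i ≟ᶠ j
  ... | no  _     | _       = _
  ... | yes _     | yes _   = _
  ... | yes fi≡fj | no  i≢j = i≢j (f-inj i j fi≡fj)

filterᵇ-≢[] : (f : A → Bool) {xs : List A} → Any (T ∘ f) xs → filterᵇ f xs ≢ []
filterᵇ-≢[] f {x ∷ _} (here fx) with f x
... | true  = λ ()
... | false = ⊥-elim fx
filterᵇ-≢[] f {x ∷ _} (there any) with f x
... | true  = λ ()
... | false = filterᵇ-≢[] f any

map-≢[] : ∀ {B : Set} (f : A → B) {xs : List A} → xs ≢ [] → map f xs ≢ []
map-≢[] f {[]}    []≢[] = ⊥-elim ([]≢[] refl)
map-≢[] f {_ ∷ _} _     = λ ()

deduplicate-≢[] : ∀ {R : A → A → Set} (R? : ∀ x y → Dec (R x y)) {xs : List A} →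
                  xs ≢ [] → deduplicate R? xs ≢ []
deduplicate-≢[] R? {[]}    []≢[] = ⊥-elim ([]≢[] refl)
deduplicate-≢[] R? {_ ∷ _} _     = λ ()

perms-≢[] : ∀ d → perms d ≢ []
perms-≢[] d = filterᵇ-≢[] isInjective (Any.map identity-isInjective (allFuns-complete d d id))
  where
  identity-isInjective : ∀ {f} → (∀ i → f i ≡ i) → T (isInjective f)
  identity-isInjective {f} f≗id =
    isInjective-complete f (λ i j fi≡fj → trans (sym (f≗id i)) (trans fi≡fj (f≗id j)))

orbit-≢[] : ∀ {d} (G : WGraph d) → orbit G ≢ []
orbit-≢[] {d} G = deduplicate-≢[] _ (map-≢[] _ (perms-≢[] d))

upperPairs-distinct : ∀ d → All (λ (i , j) → i ≢ j) (upperPairs d)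
upperPairs-distinct d = All.map (λ {(i , j)} i<j → <⇒≢ (<ᵇ⇒< (toℕ i) (toℕ j) i<j))
                                (all-filter (T? ∘ λ (i , j) → does (i <ᶠ? j)) (pairs d))

edgeFactor-pos : ∀ {d} (x : Fin d → ℚ) {a b : Fin d} → x a ≢ x b →
                 ∀ m → 0ℚ < edgeFactor x a b m
edgeFactor-pos x _     nothing  = 0<1
edgeFactor-pos x xa≢xb (just w) = even-power-pos w (p≢q⇒p-q≢0 xa≢xb)

evalS-pos : ∀ {d} (e : EdgeFun d) (x : Fin d → ℚ) → (∀ i j → x i ≡ x j → i ≡ j) →
            0ℚ < evalS e x
evalS-pos {d} e x x-inj = inv-pos (product-pos (map⁺ (All.map factor-pos (upperPairs-distinct d))))
  where
  factor-pos : ∀ {(i , j) : Fin d × Fin d} → i ≢ j → 0ℚ < edgeFactor x i j (e i j)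
  factor-pos {i , j} i≢j = edgeFactor-pos x (i≢j ∘ x-inj i j) (e i j)

evalJ-pos : ∀ {d} (G : WGraph d) (x : Fin d → ℚ) → (∀ i j → x i ≡ x j → i ≡ j) →
            0ℚ < evalJ G x
evalJ-pos G x x-inj =
  sum-pos (map-≢[] _ (orbit-≢[] G)) (map⁺ (All.universal (λ e → evalS-pos e x x-inj) (orbit G)))

fromFin : ∀ {d} → Fin d → ℚ
fromFin i = mkℚ+ (toℕ i) 1 (coprime-sym (1-coprimeTo (toℕ i)))

fromFin-injective : ∀ {d} (i j : Fin d) → fromFin i ≡ fromFin j → i ≡ j
fromFin-injective i j eq = toℕ-injective (proj₁ (mkℚ+-injective eq))

lemma3p1 : (d : ℕ) (G : WGraph d) →
    ∃[ x ] ((∀ (i j : Fin d) → x i ≡ x j → i ≡ j) × ¬ (evalJ G x ≡ 0ℚ))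
lemma3p1 d G = fromFin , fromFin-injective , λ J≡0 →
  <-irrefl (sym J≡0) (evalJ-pos G fromFin fromFin-injective)
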